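{- The following rules are admissible in $G_\mathsf{PAL}$ (for all labels $x,y$, agents $a$, $\mathcal{L}_\mathsf{PAL}$-formulas $\varphi$, and finite multisets $\Gamma,\Delta,\Gamma',\Delta'$ of relational atoms and labelled formulas): weakening $\frac{\Gamma\Rightarrow\Delta}{x:\varphi,\Gamma\Rightarrow\Delta}$ and $\frac{\Gamma\Rightarrow\Delta}{\Gamma\Rightarrow\Delta,x:\varphi}$; contraction $\frac{x:\varphi,x:\varphi,\Gamma\Rightarrow\Delta}{x:\varphi,\Gamma\Rightarrow\Delta}$ and $\frac{\Gamma\Rightarrow\Delta,x:\varphi,x:\varphi}{\Gamma\Rightarrow\Delta,x:\varphi}$; relational contraction $\frac{x\sim_ay,x\sim_ay,\Gamma\Rightarrow\Delta}{x\sim_ay,\Gamma\Rightarrow\Delta}$ and $\frac{\Gamma\Rightarrow\Delta,x\sim_ay,x\sim_ay}{\Gamma\Rightarrow\Delta,x\sim_ay}$; and cut $\frac{\Gamma\Rightarrow\Delta,x:\varphi\quad x:\varphi,\Gamma'\Rightarrow\Delta'}{\Gamma,\Gamma'\Rightarrow\Delta,\Delta'}$. (A rule is admissible if derivability in $G_\mathsf{PAL}$ of all its premises implies derivability in $G_\mathsf{PAL}$ of its conclusion.)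
   Context: Fix a denumerable set $\mathsf{Prop}$ of propositional variables and a finite set $\mathsf{Ag}$ of agents. $\mathcal{L}_\mathsf{PAL}$-formulas are given by $\varphi ::= p \mid \neg\varphi \mid \varphi\land\varphi \mid \varphi\to\varphi \mid K_a\varphi \mid [\varphi]\varphi$ with $p\in\mathsf{Prop}$, $a\in\mathsf{Ag}$. Fix a countable set of labels $x,y,z,\dots$. A relational atom is $x\sim_a y$; a labelled formula is $x:\varphi$. A labelled sequent $\Gamma\Rightarrow\Delta$ has $\Gamma,\Delta$ finite multisets of relational atoms and labelled formulas. The calculus $G_\mathsf{PAL}$ has initial sequents $x:p,\Gamma\Rightarrow\Delta,x:p$ and $x\sim_ay,\Gamma\Rightarrow\Delta,x\sim_ay$ and the rules: $(\neg\Rightarrow)\ \frac{\Gamma\Rightarrow\Delta,x:\varphi}{x:\neg\varphi,\Gamma\Rightarrow\Delta}$; $(\Rightarrow\neg)\ \frac{x:\varphi,\Gamma\Rightarrow\Delta}{\Gamma\Rightarrow\Delta,x:\neg\varphi}$; $(\land\Rightarrow)\ \frac{x:\varphi_1,x:\varphi_2,\Gamma\Rightarrow\Delta}{x:\varphi_1\land\varphi_2,\Gamma\Rightarrow\Delta}$; $(\Rightarrow\land)\ \frac{\Gamma\Rightarrow\Delta,x:\varphi_1\quad \Gamma\Rightarrow\Delta,x:\varphi_2}{\Gamma\Rightarrow\Delta,x:\varphi_1\land\varphi_2}$; $(\to\Rightarrow)\ \frac{\Gamma\Rightarrow\Delta,x:\varphi\quad x:\psi,\Gamma\Rightarrow\Delta}{x:\varphi\to\psi,\Gamma\Rightarrow\Delta}$;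 $(\Rightarrow\to)\ \frac{x:\varphi,\Gamma\Rightarrow\Delta,x:\psi}{\Gamma\Rightarrow\Delta,x:\varphi\to\psi}$; $(K_a\Rightarrow)\ \frac{y:\varphi,x:K_a\varphi,x\sim_ay,\Gamma\Rightarrow\Delta}{x:K_a\varphi,x\sim_ay,\Gamma\Rightarrow\Delta}$; $(\Rightarrow K_a)\ \frac{x\sim_ay,\Gamma\Rightarrow\Delta,y:\varphi}{\Gamma\Rightarrow\Delta,x:K_a\varphi}$ with $y$ not occurring in the conclusion; $(\mathrm{Ref}_a)\ \frac{x\sim_ax,\Gamma\Rightarrow\Delta}{\Gamma\Rightarrow\Delta}$; $(\mathrm{Trans}_a)\ \frac{x\sim_az,x\sim_ay,y\sim_az,\Gamma\Rightarrow\Delta}{x\sim_ay,y\sim_az,\Gamma\Rightarrow\Delta}$; $(\mathrm{Sym}_a)\ \frac{y\sim_ax,x\sim_ay,\Gamma\Rightarrow\Delta}{x\sim_ay,\Gamma\Rightarrow\Delta}$; and the reduction rules $(R1\Rightarrow)\ \frac{\Gamma\Rightarrow\Delta,x:\varphi\quad x:p,\Gamma\Rightarrow\Delta}{x:[\varphi]p,\Gamma\Rightarrow\Delta}$; $(\Rightarrow R1)\ \frac{x:\varphi,\Gamma\Rightarrow\Delta,x:p}{\Gamma\Rightarrow\Delta,x:[\varphi]p}$; $(R2\Rightarrow)\ \frac{\Gamma\Rightarrow\Delta,x:\varphi\quad x:\neg[\varphi]\psi,\Gamma\Rightarrow\Delta}{x:[\varphi]\neg\psi,\Gamma\Rightarrow\Delta}$;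 $(\Rightarrow R2)\ \frac{x:\varphi,\Gamma\Rightarrow\Delta,x:\neg[\varphi]\psi}{\Gamma\Rightarrow\Delta,x:[\varphi]\neg\psi}$; $(R3\Rightarrow)\ \frac{x:[\varphi]\psi_1,x:[\varphi]\psi_2,\Gamma\Rightarrow\Delta}{x:[\varphi](\psi_1\land\psi_2),\Gamma\Rightarrow\Delta}$; $(\Rightarrow R3)\ \frac{\Gamma\Rightarrow\Delta,x:[\varphi]\psi_1\quad\Gamma\Rightarrow\Delta,x:[\varphi]\psi_2}{\Gamma\Rightarrow\Delta,x:[\varphi](\psi_1\land\psi_2)}$; $(R4\Rightarrow)\ \frac{\Gamma\Rightarrow\Delta,x:[\varphi]\psi_1\quad x:[\varphi]\psi_2,\Gamma\Rightarrow\Delta}{x:[\varphi](\psi_1\to\psi_2),\Gamma\Rightarrow\Delta}$; $(\Rightarrow R4)\ \frac{x:[\varphi]\psi_1,\Gamma\Rightarrow\Delta,x:[\varphi]\psi_2}{\Gamma\Rightarrow\Delta,x:[\varphi](\psi_1\to\psi_2)}$; $(R5\Rightarrow)\ \frac{\Gamma\Rightarrow\Delta,x:\varphi\quad x:K_a[\varphi]\psi,\Gamma\Rightarrow\Delta}{x:[\varphi]K_a\psi,\Gamma\Rightarrow\Delta}$; $(\Rightarrow R5)\ \frac{x:\varphi,\Gamma\Rightarrow\Delta,x:K_a[\varphi]\psi}{\Gamma\Rightarrow\Delta,x:[\varphi]K_a\psi}$; $(R6\Rightarrow)\ \frac{x:[\varphi\land[\varphi]\psi]\chi,\Gamma\Rightarrow\Delta}{x:[\varphi][\psi]\chi,\Gamma\Rightarrow\Delta}$;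 $(\Rightarrow R6)\ \frac{\Gamma\Rightarrow\Delta,x:[\varphi\land[\varphi]\psi]\chi}{\Gamma\Rightarrow\Delta,x:[\varphi][\psi]\chi}$. Derivations are finite trees built from these rules with initial sequents at the leaves. -}

module Defs where

open import Data.Nat using (ℕ)
open import Data.Fin using (Fin)
open import Data.List using (List; []; _∷_; _++_)
open import Data.List.Membership.Propositional using (_∈_; _∉_)
open import Data.List.Relation.Binary.Permutation.Propositional using (_↭_)
open import Relation.Binary.PropositionalEquality using (_≢_)

module PAL (n : ℕ) where

  Agent : Set
  Agent = Fin n

  PVar : Set
  PVar = ℕ

  Label : Set
  Label = ℕ

  data Fm : Set where
    var  : PVar → Fm
    ¬'_  : Fm → Fm
    _∧'_ : Fm → Fm → Fm
    _→'_ : Fm → Fm → Fm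
    K    : Agent → Fm → Fm
    [_]_ : Fm → Fm → Fm

  data Item : Set where
    rel : Label → Agent → Label → Item     -- rel x a y  is  x ∼_a y
    lab : Label → Fm → Item                -- lab x φ    is  x : φ

  -- a multiset is represented by a list, taken up to permutation (rule `exch`)
  Ctx : Set
  Ctx = List Item

  labelsI : Item → List Label
  labelsI (rel x a y) = x ∷ y ∷ []
  labelsI (lab x φ)   = x ∷ []

  labels : Ctx → List Label
  labels []       = []
  labels (i ∷ Γ)  = labelsI i ++ labels Γ

  infix 3 _⇒_
  data _⇒_ : Ctx → Ctx → Set where
    exch : ∀ {Γ Γ' Δ Δ'} → Γ ↭ Γ' → Δ ↭ Δ' → Γ ⇒ Δ → Γ' ⇒ Δ'
    initP : ∀ {x p Γ Δ} → lab x (var p) ∷ Γ ⇒ Δ ++ lab x (var p) ∷ []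
    initR : ∀ {x a y Γ Δ} → rel x a y ∷ Γ ⇒ Δ ++ rel x a y ∷ []
    ¬L : ∀ {x φ Γ Δ} → Γ ⇒ Δ ++ lab x φ ∷ [] → lab x (¬' φ) ∷ Γ ⇒ Δ
    ¬R : ∀ {x φ Γ Δ} → lab x φ ∷ Γ ⇒ Δ → Γ ⇒ Δ ++ lab x (¬' φ) ∷ []
    ∧L : ∀ {x φ ψ Γ Δ} → lab x φ ∷ lab x ψ ∷ Γ ⇒ Δ → lab x (φ ∧' ψ) ∷ Γ ⇒ Δ
    ∧R : ∀ {x φ ψ Γ Δ} → Γ ⇒ Δ ++ lab x φ ∷ [] → Γ ⇒ Δ ++ lab x ψ ∷ []
         → Γ ⇒ Δ ++ lab x (φ ∧' ψ) ∷ []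
    →L : ∀ {x φ ψ Γ Δ} → Γ ⇒ Δ ++ lab x φ ∷ [] → lab x ψ ∷ Γ ⇒ Δ
         → lab x (φ →' ψ) ∷ Γ ⇒ Δ
    →R : ∀ {x φ ψ Γ Δ} → lab x φ ∷ Γ ⇒ Δ ++ lab x ψ ∷ []
         → Γ ⇒ Δ ++ lab x (φ →' ψ) ∷ []
    KL : ∀ {x y a φ Γ Δ} → lab y φ ∷ lab x (K a φ) ∷ rel x a y ∷ Γ ⇒ Δ
         → lab x (K a φ) ∷ rel x a y ∷ Γ ⇒ Δ
    KR : ∀ {x y a φ Γ Δ} → y ∉ labels (Γ ++ Δ) → y ≢ x
         → rel x a y ∷ Γ ⇒ Δ ++ lab y φ ∷ []
         → Γ ⇒ Δ ++ lab x (K a φ) ∷ []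
    Ref   : ∀ {x a Γ Δ} → rel x a x ∷ Γ ⇒ Δ → Γ ⇒ Δ
    Trans : ∀ {x y z a Γ Δ} → rel x a z ∷ rel x a y ∷ rel y a z ∷ Γ ⇒ Δ
            → rel x a y ∷ rel y a z ∷ Γ ⇒ Δ
    Sym   : ∀ {x y a Γ Δ} → rel y a x ∷ rel x a y ∷ Γ ⇒ Δ → rel x a y ∷ Γ ⇒ Δ
    R1L : ∀ {x φ p Γ Δ} → Γ ⇒ Δ ++ lab x φ ∷ [] → lab x (var p) ∷ Γ ⇒ Δ
          → lab x ([ φ ] var p) ∷ Γ ⇒ Δ
    R1R : ∀ {x φ p Γ Δ} → lab x φ ∷ Γ ⇒ Δ ++ lab x (var p) ∷ []
          → Γ ⇒ Δ ++ lab x ([ φ ] var p) ∷ []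
    R2L : ∀ {x φ ψ Γ Δ} → Γ ⇒ Δ ++ lab x φ ∷ [] → lab x (¬' ([ φ ] ψ)) ∷ Γ ⇒ Δ
          → lab x ([ φ ] (¬' ψ)) ∷ Γ ⇒ Δ
    R2R : ∀ {x φ ψ Γ Δ} → lab x φ ∷ Γ ⇒ Δ ++ lab x (¬' ([ φ ] ψ)) ∷ []
          → Γ ⇒ Δ ++ lab x ([ φ ] (¬' ψ)) ∷ []
    R3L : ∀ {x φ ψ₁ ψ₂ Γ Δ} → lab x ([ φ ] ψ₁) ∷ lab x ([ φ ] ψ₂) ∷ Γ ⇒ Δ
          → lab x ([ φ ] (ψ₁ ∧' ψ₂)) ∷ Γ ⇒ Δ
    R3R : ∀ {x φ ψ₁ ψ₂ Γ Δ} → Γ ⇒ Δ ++ lab x ([ φ ] ψ₁) ∷ []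
          → Γ ⇒ Δ ++ lab x ([ φ ] ψ₂) ∷ []
          → Γ ⇒ Δ ++ lab x ([ φ ] (ψ₁ ∧' ψ₂)) ∷ []
    R4L : ∀ {x φ ψ₁ ψ₂ Γ Δ} → Γ ⇒ Δ ++ lab x ([ φ ] ψ₁) ∷ []
          → lab x ([ φ ] ψ₂) ∷ Γ ⇒ Δ
          → lab x ([ φ ] (ψ₁ →' ψ₂)) ∷ Γ ⇒ Δ
    R4R : ∀ {x φ ψ₁ ψ₂ Γ Δ} → lab x ([ φ ] ψ₁) ∷ Γ ⇒ Δ ++ lab x ([ φ ] ψ₂) ∷ []
          → Γ ⇒ Δ ++ lab x ([ φ ] (ψ₁ →' ψ₂)) ∷ []
    R5L : ∀ {x a φ ψ Γ Δ} → Γ ⇒ Δ ++ lab x φ ∷ [] → lab x (K a ([ φ ] ψ)) ∷ Γ ⇒ Δ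
          → lab x ([ φ ] K a ψ) ∷ Γ ⇒ Δ
    R5R : ∀ {x a φ ψ Γ Δ} → lab x φ ∷ Γ ⇒ Δ ++ lab x (K a ([ φ ] ψ)) ∷ []
          → Γ ⇒ Δ ++ lab x ([ φ ] K a ψ) ∷ []
    R6L : ∀ {x φ ψ χ Γ Δ} → lab x ([ φ ∧' ([ φ ] ψ) ] χ) ∷ Γ ⇒ Δ
          → lab x ([ φ ] ([ ψ ] χ)) ∷ Γ ⇒ Δ
    R6R : ∀ {x φ ψ χ Γ Δ} → Γ ⇒ Δ ++ lab x ([ φ ∧' ([ φ ] ψ) ] χ) ∷ []
          → Γ ⇒ Δ ++ lab x ([ φ ] ([ ψ ] χ)) ∷ []

module Submission where

open import Defs
open import Data.Bool using (Bool; true; false)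
open import Data.Empty using (⊥; ⊥-elim)
open import Data.List using (List; []; _∷_; _++_; map)
open import Data.List.Extrema.Nat using (max; xs≤max)
open import Data.List.Membership.Propositional using (_∈_; _∉_)
open import Data.List.Membership.Propositional.Properties
  using (∈-++⁺ˡ; ∈-++⁺ʳ; ∈-++⁻; ∈-∃++; ∈-map⁺)
open import Data.List.Properties using (map-++; map-∘) renaming (++-assoc to ++-assoc-≡)
open import Data.List.Relation.Binary.Permutation.Propositional
open import Data.List.Relation.Binary.Permutation.Propositional.Properties
  using (∈-resp-↭; ++⁺ˡ; ++⁺ʳ; shift; shifts; drop-∷; ++-comm; map⁺)
open import Data.List.Relation.Unary.All as All using (All; []; _∷_)
open import Data.List.Relation.Unary.All.Properties using () renaming (map⁺ to All-map⁺)
open import Data.List.Relation.Unary.Any using (here; there)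
open import Data.Nat using (ℕ; suc; _+_; _*_; _<_; s≤s; z≤n; _≟_; s≤s⁻¹; NonZero; >-nonZero⁻¹)
open import Data.Nat.Properties
open import Data.Nat.Solver using (module +-*-Solver)
open import Data.Product using (_×_; _,_; ∃)
open import Data.Sum using (_⊎_; inj₁; inj₂)
open import Data.Unit using (⊤; tt)
open import Function using (_∘_)
open import Relation.Binary.PropositionalEquality as ≡
  using (_≡_; _≢_; refl; cong; cong₂; subst; subst₂)
open import Relation.Nullary using (yes; no)

-- Each reduction axiom presents [φ]ψ as a formula built by one connective from simpler pieces ([φ]p like
-- φ → p, [φ]¬ψ like φ → ¬[φ]ψ, [φ][ψ]χ like [φ ∧ [φ]ψ]χ, ...), so G_PAL behaves like a labelled calculus
-- for a modal logic with a few connectives. Derivations are recast in an equivalent calculus in which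
-- exchange is absorbed into every rule and K-right has a premise for every label outside a finite set; there
-- weakening and renaming of labels are structural, and every rule for a compound formula is invertible by
-- replacing its principal formula throughout a derivation. Contraction and cut then go by induction on a
-- weight that strictly decreases from a formula to its pieces: a compound formula is contracted or cut by
-- inverting its rules on both sides, an atom in the succedent occurs only in initial sequents, and a boxed
-- formula in the antecedent is used only by K-left, where the cut moves to the instance of the K-right
-- premise at the accessible label.

m<[4+m]*n : ∀ m n .{{_ : NonZero n}} → m < (4 + m) * n
m<[4+m]*n m n = ≤-trans (s≤s (m≤n+m m 3)) (m≤m*n (4 + m) n)

1+[4+m]*n<[4+m]*[1+n] : ∀ m n → suc ((4 + m) * n) < (4 + m) * suc n
1+[4+m]*n<[4+m]*[1+n] m n =
  subst (suc ((4 + m) * n) <_) (≡.sym (*-suc (4 + m) n)) (s≤s (s≤s (m≤n+m _ (suc (suc m)))))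

[5+a+[4+a]*b]*w<[4+a]*[[4+b]*w] : ∀ a b w .{{_ : NonZero w}} →
  (5 + a + (4 + a) * b) * w < (4 + a) * ((4 + b) * w)
[5+a+[4+a]*b]*w<[4+a]*[[4+b]*w] a b w =
  subst ((5 + a + (4 + a) * b) * w <_) (identity a b w)
    (m<m+n _ (>-nonZero⁻¹ ((11 + 3 * a) * w) {{m*n≢0 (11 + 3 * a) w}}))
  where
  open +-*-Solver
  identity : ∀ a b w → (5 + a + (4 + a) * b) * w + (11 + 3 * a) * w ≡ (4 + a) * ((4 + b) * w)
  identity = solve 3 (λ a b w →
    (con 5 :+ a :+ (con 4 :+ a) :* b) :* w :+ (con 11 :+ con 3 :* a) :* w
      := (con 4 :+ a) :* ((con 4 :+ b) :* w)) refl

module Admissibility (n : ℕ) where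
  open PAL n

  private variable
    x y : Label
    a : Agent
    F φ : Fm
    it : Item
    Γ Γ' Γ₀ Δ Δ' Δ₀ X Y Θ : Ctx

  data Kind : Set where
    atomic modal : Kind
    neg          : Fm → Kind
    conj imp     : Fm → Fm → Kind
    unfold       : Fm → Kind

  -- The reduction axioms let [φ]ψ be decomposed exactly like the right-hand side of its axiom.
  kind : Fm → Kind
  kind (var p)                = atomic
  kind (K a φ)                = modal
  kind (¬' φ)                 = neg φ
  kind (φ ∧' ψ)               = conj φ ψ
  kind (φ →' ψ)               = imp φ ψ
  kind ([ φ ] var p)          = imp φ (var p)
  kind ([ φ ] (¬' ψ))         = imp φ (¬' ([ φ ] ψ))
  kind ([ φ ] (ψ₁ ∧' ψ₂))     = conj ([ φ ] ψ₁) ([ φ ] ψ₂)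
  kind ([ φ ] (ψ₁ →' ψ₂))     = imp ([ φ ] ψ₁) ([ φ ] ψ₂)
  kind ([ φ ] K a ψ)          = imp φ (K a ([ φ ] ψ))
  kind ([ φ ] ([ ψ ] χ))      = unfold ([ φ ∧' ([ φ ] ψ) ] χ)

  Compound : Kind → Set
  Compound atomic = ⊥
  Compound modal  = ⊥
  Compound _      = ⊤

  data Shape : Fm → Set where
    atomic   : ∀ p → Shape (var p)
    modal    : ∀ a φ → Shape (K a φ)
    compound : Compound (kind F) → Shape F

  []-compound : ∀ φ ψ → Compound (kind ([ φ ] ψ))
  []-compound φ (var p)   = tt
  []-compound φ (¬' ψ)    = tt
  []-compound φ (ψ ∧' χ)  = tt
  []-compound φ (ψ →' χ)  = tt
  []-compound φ (K a ψ)   = tt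
  []-compound φ ([ ψ ] χ) = tt

  shape : ∀ F → Shape F
  shape (var p)   = atomic p
  shape (K a φ)   = modal a φ
  shape (¬' φ)    = compound tt
  shape (φ ∧' ψ)  = compound tt
  shape (φ →' ψ)  = compound tt
  shape ([ φ ] ψ) = compound ([]-compound φ ψ)

  components : Kind → List Fm
  components atomic     = []
  components modal      = []
  components (neg A)    = A ∷ []
  components (conj A B) = A ∷ B ∷ []
  components (imp A B)  = A ∷ B ∷ []
  components (unfold A) = A ∷ []

  L-Branch R-Branch : Kind → Set
  L-Branch atomic     = ⊥
  L-Branch modal      = ⊥
  L-Branch (imp _ _)  = Bool
  L-Branch _          = ⊤
  R-Branch atomic     = ⊥
  R-Branch modal      = ⊥
  R-Branch (conj _ _) = Bool
  R-Branch _          = ⊤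

  -- The formulas that premise i of the left (L-) or right (R-) rule for a kind adds to its antecedent (ˡ)
  -- or succedent (ʳ).
  L-premiseˡ L-premiseʳ : (k : Kind) → L-Branch k → List Fm
  L-premiseˡ (neg A)    _     = []
  L-premiseˡ (conj A B) _     = A ∷ B ∷ []
  L-premiseˡ (imp A B)  true  = []
  L-premiseˡ (imp A B)  false = B ∷ []
  L-premiseˡ (unfold A) _     = A ∷ []
  L-premiseʳ (neg A)    _     = A ∷ []
  L-premiseʳ (conj A B) _     = []
  L-premiseʳ (imp A B)  true  = A ∷ []
  L-premiseʳ (imp A B)  false = []
  L-premiseʳ (unfold A) _     = []

  R-premiseˡ R-premiseʳ : (k : Kind) → R-Branch k → List Fm
  R-premiseˡ (neg A)    _     = A ∷ []
  R-premiseˡ (conj A B) _     = []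
  R-premiseˡ (imp A B)  _     = A ∷ []
  R-premiseˡ (unfold A) _     = []
  R-premiseʳ (neg A)    _     = []
  R-premiseʳ (conj A B) true  = A ∷ []
  R-premiseʳ (conj A B) false = B ∷ []
  R-premiseʳ (imp A B)  _     = B ∷ []
  R-premiseʳ (unfold A) _     = A ∷ []

  module _ {P : Fm → Set} where
    All-L-premiseˡ : ∀ k i → All P (components k) → All P (L-premiseˡ k i)
    All-L-premiseˡ (neg A)    _     _               = []
    All-L-premiseˡ (conj A B) _     all             = all
    All-L-premiseˡ (imp A B)  true  _               = []
    All-L-premiseˡ (imp A B)  false (_ ∷ pB ∷ [])   = pB ∷ []
    All-L-premiseˡ (unfold A) _     all             = all

    All-L-premiseʳ : ∀ k i → All P (components k) → All P (L-premiseʳ k i)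
    All-L-premiseʳ (neg A)    _     all             = all
    All-L-premiseʳ (conj A B) _     _               = []
    All-L-premiseʳ (imp A B)  true  (pA ∷ _)        = pA ∷ []
    All-L-premiseʳ (imp A B)  false _               = []
    All-L-premiseʳ (unfold A) _     _               = []

    All-R-premiseˡ : ∀ k i → All P (components k) → All P (R-premiseˡ k i)
    All-R-premiseˡ (neg A)    _     all             = all
    All-R-premiseˡ (conj A B) _     _               = []
    All-R-premiseˡ (imp A B)  _     (pA ∷ _)        = pA ∷ []
    All-R-premiseˡ (unfold A) _     _               = []

    All-R-premiseʳ : ∀ k i → All P (components k) → All P (R-premiseʳ k i)
    All-R-premiseʳ (neg A)    _     _               = []
    All-R-premiseʳ (conj A B) true  (pA ∷ _)        = pA ∷ []
    All-R-premiseʳ (conj A B) false (_ ∷ pB ∷ [])   = pB ∷ []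
    All-R-premiseʳ (imp A B)  _     (_ ∷ pB ∷ [])   = pB ∷ []
    All-R-premiseʳ (unfold A) _     all             = all

  -- The factor 4 makes every reduction axiom decrease the weight, R6 included.
  weight : Fm → ℕ
  weight (var p)   = 1
  weight (¬' φ)    = suc (weight φ)
  weight (φ ∧' ψ)  = suc (weight φ + weight ψ)
  weight (φ →' ψ)  = suc (weight φ + weight ψ)
  weight (K a φ)   = suc (weight φ)
  weight ([ φ ] ψ) = (4 + weight φ) * weight ψ

  weight-nonZero : ∀ φ → NonZero (weight φ)
  weight-nonZero (var p)   = _
  weight-nonZero (¬' φ)    = _
  weight-nonZero (φ ∧' ψ)  = _
  weight-nonZero (φ →' ψ)  = _
  weight-nonZero (K a φ)   = _
  weight-nonZero ([ φ ] ψ) = m*n≢0 (4 + weight φ) (weight ψ) {{_}} {{weight-nonZero ψ}}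

  Lighter : ℕ → Fm → Set
  Lighter N G = weight G < N

  weight<weight[]ˡ : ∀ φ ψ → weight φ < weight ([ φ ] ψ)
  weight<weight[]ˡ φ ψ = m<[4+m]*n (weight φ) (weight ψ) {{weight-nonZero ψ}}

  weight[]-monoʳ-< : ∀ φ ψ χ → weight ψ < weight χ → weight ([ φ ] ψ) < weight ([ φ ] χ)
  weight[]-monoʳ-< φ _ _ = *-monoʳ-< (4 + weight φ)

  components-lighter : ∀ F → All (Lighter (weight F)) (components (kind F))
  components-lighter (var p)   = []
  components-lighter (K a φ)   = []
  components-lighter (¬' φ)    = n<1+n (weight φ) ∷ []
  components-lighter (φ ∧' ψ)  = s≤s (m≤m+n _ _) ∷ s≤s (m≤n+m _ _) ∷ []
  components-lighter (φ →' ψ)  = s≤s (m≤m+n _ _) ∷ s≤s (m≤n+m _ _) ∷ []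
  components-lighter ([ φ ] var p) = weight<weight[]ˡ φ (var p) ∷ s≤s (s≤s z≤n) ∷ []
  components-lighter ([ φ ] (¬' ψ)) =
    weight<weight[]ˡ φ (¬' ψ) ∷ 1+[4+m]*n<[4+m]*[1+n] (weight φ) (weight ψ) ∷ []
  components-lighter ([ φ ] (ψ₁ ∧' ψ₂)) =
    weight[]-monoʳ-< φ ψ₁ (ψ₁ ∧' ψ₂) (s≤s (m≤m+n _ _))
      ∷ weight[]-monoʳ-< φ ψ₂ (ψ₁ ∧' ψ₂) (s≤s (m≤n+m _ _)) ∷ []
  components-lighter ([ φ ] (ψ₁ →' ψ₂)) =
    weight[]-monoʳ-< φ ψ₁ (ψ₁ →' ψ₂) (s≤s (m≤m+n _ _))
      ∷ weight[]-monoʳ-< φ ψ₂ (ψ₁ →' ψ₂) (s≤s (m≤n+m _ _)) ∷ []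
  components-lighter ([ φ ] K a ψ) =
    weight<weight[]ˡ φ (K a ψ) ∷ 1+[4+m]*n<[4+m]*[1+n] (weight φ) (weight ψ) ∷ []
  components-lighter ([ φ ] ([ ψ ] χ)) =
    [5+a+[4+a]*b]*w<[4+a]*[[4+b]*w] (weight φ) (weight ψ) (weight χ) {{weight-nonZero χ}} ∷ []

  -- The calculus ⊢

  labs : Label → List Fm → Ctx
  labs x = map (lab x)

  -- A rule instance consumes its principal items, requires its side items to stay in the context, and each
  -- premise adds its items to the remaining context.
  data Rule : Set where
    axP          : Label → PVar → Rule
    axR          : Label → Agent → Label → Rule
    compL compR  : (x : Label) (F : Fm) → Compound (kind F) → Rule
    boxL         : (x : Label) (a : Agent) (φ : Fm) (y : Label) → Rule
    boxR         : (x : Label) (a : Agent) (φ : Fm) (used : List Label) → Rule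
    reflexivity  : Label → Agent → Rule
    transitivity : Label → Label → Label → Agent → Rule
    symmetry     : Label → Label → Agent → Rule

  -- boxR has a premise for every label outside `used`; this makes derivations closed under renaming.
  Branch : Rule → Set
  Branch (axP _ _)         = ⊥
  Branch (axR _ _ _)       = ⊥
  Branch (compL _ F _)     = L-Branch (kind F)
  Branch (compR _ F _)     = R-Branch (kind F)
  Branch (boxR _ _ _ used) = ∃ λ y → y ∉ used
  Branch _                 = ⊤

  principalˡ principalʳ sideˡ sideʳ : Rule → Ctx
  principalˡ (compL x F _)     = lab x F ∷ []
  principalˡ _                 = []
  principalʳ (compR x F _)     = lab x F ∷ []
  principalʳ (boxR x a φ _)    = lab x (K a φ) ∷ []
  principalʳ _                 = []
  sideˡ (axP x p)              = lab x (var p) ∷ []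
  sideˡ (axR x a y)            = rel x a y ∷ []
  sideˡ (boxL x a φ y)         = lab x (K a φ) ∷ rel x a y ∷ []
  sideˡ (transitivity x y z a) = rel x a y ∷ rel y a z ∷ []
  sideˡ (symmetry x y a)       = rel x a y ∷ []
  sideˡ _                      = []
  sideʳ (axP x p)              = lab x (var p) ∷ []
  sideʳ (axR x a y)            = rel x a y ∷ []
  sideʳ _                      = []

  premiseˡ premiseʳ : (r : Rule) → Branch r → Ctx
  premiseˡ (axP _ _) ()
  premiseˡ (axR _ _ _) ()
  premiseˡ (compL x F _) i          = labs x (L-premiseˡ (kind F) i)
  premiseˡ (compR x F _) i          = labs x (R-premiseˡ (kind F) i)
  premiseˡ (boxL x a φ y) _         = lab y φ ∷ []
  premiseˡ (boxR x a φ _) (y , _)   = rel x a y ∷ []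
  premiseˡ (reflexivity x a) _      = rel x a x ∷ []
  premiseˡ (transitivity x y z a) _ = rel x a z ∷ []
  premiseˡ (symmetry x y a) _       = rel y a x ∷ []
  premiseʳ (compL x F _) i          = labs x (L-premiseʳ (kind F) i)
  premiseʳ (compR x F _) i          = labs x (R-premiseʳ (kind F) i)
  premiseʳ (boxR x a φ _) (y , _)   = lab y φ ∷ []
  premiseʳ _ _                      = []

  infix 3 _⊢_
  data _⊢_ : Ctx → Ctx → Set where
    node : (r : Rule) (Γ₀ Δ₀ : Ctx) → Γ ↭ principalˡ r ++ Γ₀ → Δ ↭ principalʳ r ++ Δ₀
         → All (_∈ Γ₀) (sideˡ r) → All (_∈ Δ₀) (sideʳ r)
         → (∀ i → premiseˡ r i ++ Γ₀ ⊢ premiseʳ r i ++ Δ₀)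
         → Γ ⊢ Δ

  ⊢-exch : Γ ↭ Γ' → Δ ↭ Δ' → Γ ⊢ Δ → Γ' ⊢ Δ'
  ⊢-exch Γ↭Γ' Δ↭Δ' (node r Γ₀ Δ₀ Γ↭ Δ↭ sideΓ sideΔ prems) =
    node r Γ₀ Δ₀ (↭-trans (↭-sym Γ↭Γ') Γ↭) (↭-trans (↭-sym Δ↭Δ') Δ↭) sideΓ sideΔ prems

  ⊢-exchˡ : Γ ↭ Γ' → Γ ⊢ Δ → Γ' ⊢ Δ
  ⊢-exchˡ p = ⊢-exch p ↭-refl

  ⊢-exchʳ : Δ ↭ Δ' → Γ ⊢ Δ → Γ ⊢ Δ'
  ⊢-exchʳ = ⊢-exch ↭-refl

  ⊢-weaken : ∀ Γ' Δ' → Γ ⊢ Δ → Γ' ++ Γ ⊢ Δ' ++ Δ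
  ⊢-weaken Γ' Δ' (node r Γ₀ Δ₀ Γ↭ Δ↭ sideΓ sideΔ prems) =
    node r (Γ' ++ Γ₀) (Δ' ++ Δ₀)
      (↭-trans (++⁺ˡ Γ' Γ↭) (shifts Γ' (principalˡ r))) (↭-trans (++⁺ˡ Δ' Δ↭) (shifts Δ' (principalʳ r)))
      (All.map (∈-++⁺ʳ Γ') sideΓ) (All.map (∈-++⁺ʳ Δ') sideΔ)
      (λ i → ⊢-exch (shifts Γ' (premiseˡ r i)) (shifts Δ' (premiseʳ r i)) (⊢-weaken Γ' Δ' (prems i)))

  data PrincipalˡView : Rule → Item → Set where
    compL : ∀ {x F} p → PrincipalˡView (compL x F p) (lab x F)

  principalˡ-view : ∀ r → it ∈ principalˡ r → PrincipalˡView r it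
  principalˡ-view (compL x F p) (here refl) = compL p
  principalˡ-view (compL x F p) (there ())
  principalˡ-view (axP _ _) ()
  principalˡ-view (axR _ _ _) ()
  principalˡ-view (compR _ _ _) ()
  principalˡ-view (boxL _ _ _ _) ()
  principalˡ-view (boxR _ _ _ _) ()
  principalˡ-view (reflexivity _ _) ()
  principalˡ-view (transitivity _ _ _ _) ()
  principalˡ-view (symmetry _ _ _) ()

  data PrincipalʳView : Rule → Item → Set where
    compR : ∀ {x F} p → PrincipalʳView (compR x F p) (lab x F)
    boxR  : ∀ {x a φ} used → PrincipalʳView (boxR x a φ used) (lab x (K a φ))

  principalʳ-view : ∀ r → it ∈ principalʳ r → PrincipalʳView r it
  principalʳ-view (compR x F p) (here refl) = compR p
  principalʳ-view (compR x F p) (there ())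
  principalʳ-view (boxR x a φ used) (here refl) = boxR used
  principalʳ-view (boxR x a φ used) (there ())
  principalʳ-view (axP _ _) ()
  principalʳ-view (axR _ _ _) ()
  principalʳ-view (compL _ _ _) ()
  principalʳ-view (boxL _ _ _ _) ()
  principalʳ-view (reflexivity _ _) ()
  principalʳ-view (transitivity _ _ _ _) ()
  principalʳ-view (symmetry _ _ _) ()

  data LabSideˡView : Rule → Label → Fm → Set where
    axP  : ∀ {x p} → LabSideˡView (axP x p) x (var p)
    boxL : ∀ {x a φ y} → LabSideˡView (boxL x a φ y) x (K a φ)

  lab-sideˡ-view : ∀ r → lab x F ∈ sideˡ r → LabSideˡView r x F
  lab-sideˡ-view (axP _ _) (here refl) = axP
  lab-sideˡ-view (axP _ _) (there ())
  lab-sideˡ-view (axR _ _ _) (here ())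
  lab-sideˡ-view (axR _ _ _) (there ())
  lab-sideˡ-view (boxL _ _ _ _) (here refl) = boxL
  lab-sideˡ-view (boxL _ _ _ _) (there (here ()))
  lab-sideˡ-view (boxL _ _ _ _) (there (there ()))
  lab-sideˡ-view (transitivity _ _ _ _) (here ())
  lab-sideˡ-view (transitivity _ _ _ _) (there (here ()))
  lab-sideˡ-view (transitivity _ _ _ _) (there (there ()))
  lab-sideˡ-view (symmetry _ _ _) (here ())
  lab-sideˡ-view (symmetry _ _ _) (there ())
  lab-sideˡ-view (compL _ _ _) ()
  lab-sideˡ-view (compR _ _ _) ()
  lab-sideˡ-view (boxR _ _ _ _) ()
  lab-sideˡ-view (reflexivity _ _) ()

  data LabSideʳView : Rule → Label → Fm → Set where
    axP : ∀ {x p} → LabSideʳView (axP x p) x (var p)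

  lab-sideʳ-view : ∀ r → lab x F ∈ sideʳ r → LabSideʳView r x F
  lab-sideʳ-view (axP _ _) (here refl) = axP
  lab-sideʳ-view (axP _ _) (there ())
  lab-sideʳ-view (axR _ _ _) (here ())
  lab-sideʳ-view (axR _ _ _) (there ())
  lab-sideʳ-view (compL _ _ _) ()
  lab-sideʳ-view (compR _ _ _) ()
  lab-sideʳ-view (boxL _ _ _ _) ()
  lab-sideʳ-view (boxR _ _ _ _) ()
  lab-sideʳ-view (reflexivity _ _) ()
  lab-sideʳ-view (transitivity _ _ _ _) ()
  lab-sideʳ-view (symmetry _ _ _) ()

  rel∉principalˡ : ∀ {z} r → rel x a z ∉ principalˡ r
  rel∉principalˡ r m with principalˡ-view r m
  ... | ()

  rel∉principalʳ : ∀ {z} r → rel x a z ∉ principalʳ r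
  rel∉principalʳ r m with principalʳ-view r m
  ... | ()

  var∉principalˡ : ∀ {p} r → lab x (var p) ∉ principalˡ r
  var∉principalˡ r m with principalˡ-view r m
  ... | compL ()

  var∉principalʳ : ∀ {p} r → lab x (var p) ∉ principalʳ r
  var∉principalʳ r m with principalʳ-view r m
  ... | compR ()

  K∉principalˡ : ∀ {φ} r → lab x (K a φ) ∉ principalˡ r
  K∉principalˡ r m with principalˡ-view r m
  ... | compL ()

  -- Renaming of labels

  fresh : (L : List Label) → ∃ λ y → y ∉ L
  fresh L = suc (max 0 L) , λ y∈L → <-irrefl refl (All.lookup (xs≤max 0 L) y∈L)

  module Renaming (u v : Label) where

    ρ : Label → Label
    ρ w with w ≟ u
    ... | yes _ = v
    ... | no  _ = w

    ρ-≢ : ∀ {w} → w ≢ u → ρ w ≡ w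
    ρ-≢ {w} w≢u with w ≟ u
    ... | yes w≡u = ⊥-elim (w≢u w≡u)
    ... | no  _   = refl

    ρ-u : ρ u ≡ v
    ρ-u with u ≟ u
    ... | yes _   = refl
    ... | no  u≢u = ⊥-elim (u≢u refl)

    ρItem : Item → Item
    ρItem (rel x a y) = rel (ρ x) a (ρ y)
    ρItem (lab x F)   = lab (ρ x) F

    ρCtx : Ctx → Ctx
    ρCtx = map ρItem

    -- u is added to `used`, so the premises kept by a renamed boxR are those at labels fixed by ρ.
    ρRule : Rule → Rule
    ρRule (axP x p)              = axP (ρ x) p
    ρRule (axR x a y)            = axR (ρ x) a (ρ y)
    ρRule (compL x F p)          = compL (ρ x) F p
    ρRule (compR x F p)          = compR (ρ x) F p
    ρRule (boxL x a φ y)         = boxL (ρ x) a φ (ρ y)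
    ρRule (boxR x a φ used)      = boxR (ρ x) a φ (u ∷ used)
    ρRule (reflexivity x a)      = reflexivity (ρ x) a
    ρRule (transitivity x y z a) = transitivity (ρ x) (ρ y) (ρ z) a
    ρRule (symmetry x y a)       = symmetry (ρ x) (ρ y) a

    ρBranch : ∀ r → Branch (ρRule r) → Branch r
    ρBranch (compL _ _ _) i            = i
    ρBranch (compR _ _ _) i            = i
    ρBranch (boxL _ _ _ _) _           = tt
    ρBranch (boxR _ _ _ _) (y , y∉)    = y , y∉ ∘ there
    ρBranch (reflexivity _ _) _        = tt
    ρBranch (transitivity _ _ _ _) _   = tt
    ρBranch (symmetry _ _ _) _         = tt

    ρRule-conclusion : ∀ r →
      principalˡ (ρRule r) ≡ ρCtx (principalˡ r) × principalʳ (ρRule r) ≡ ρCtx (principalʳ r)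
      × sideˡ (ρRule r) ≡ ρCtx (sideˡ r) × sideʳ (ρRule r) ≡ ρCtx (sideʳ r)
    ρRule-conclusion (axP _ _)              = refl , refl , refl , refl
    ρRule-conclusion (axR _ _ _)            = refl , refl , refl , refl
    ρRule-conclusion (compL _ _ _)          = refl , refl , refl , refl
    ρRule-conclusion (compR _ _ _)          = refl , refl , refl , refl
    ρRule-conclusion (boxL _ _ _ _)         = refl , refl , refl , refl
    ρRule-conclusion (boxR _ _ _ _)         = refl , refl , refl , refl
    ρRule-conclusion (reflexivity _ _)      = refl , refl , refl , refl
    ρRule-conclusion (transitivity _ _ _ _) = refl , refl , refl , refl
    ρRule-conclusion (symmetry _ _ _)       = refl , refl , refl , refl

    ρ-labs : ∀ x fs → labs (ρ x) fs ≡ ρCtx (labs x fs)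
    ρ-labs x = map-∘ {g = ρItem} {f = lab x}

    ρRule-premise : ∀ r i →
      premiseˡ (ρRule r) i ≡ ρCtx (premiseˡ r (ρBranch r i))
      × premiseʳ (ρRule r) i ≡ ρCtx (premiseʳ r (ρBranch r i))
    ρRule-premise (compL x F _) i          =
      ρ-labs x (L-premiseˡ (kind F) i) , ρ-labs x (L-premiseʳ (kind F) i)
    ρRule-premise (compR x F _) i          =
      ρ-labs x (R-premiseˡ (kind F) i) , ρ-labs x (R-premiseʳ (kind F) i)
    ρRule-premise (boxL _ _ _ _) _         = refl , refl
    ρRule-premise (boxR x a φ _) (y , y∉)  =
      cong (λ w → rel (ρ x) a w ∷ []) (≡.sym y-fixed) , cong (λ w → lab w φ ∷ []) (≡.sym y-fixed)
      where
      y-fixed : ρ y ≡ y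
      y-fixed = ρ-≢ (y∉ ∘ here)
    ρRule-premise (reflexivity _ _) _      = refl , refl
    ρRule-premise (transitivity _ _ _ _) _ = refl , refl
    ρRule-premise (symmetry _ _ _) _       = refl , refl

    ρ-↭ : ∀ Θ → Γ ↭ Θ ++ Γ₀ → ρCtx Γ ↭ ρCtx Θ ++ ρCtx Γ₀
    ρ-↭ {Γ₀ = Γ₀} Θ p = ↭-trans (map⁺ ρItem p) (↭-reflexive (map-++ ρItem Θ Γ₀))

    ρ-∈ : All (_∈ Γ₀) Θ → All (_∈ ρCtx Γ₀) (ρCtx Θ)
    ρ-∈ all = All-map⁺ (All.map (∈-map⁺ ρItem) all)

    ⊢-rename : Γ ⊢ Δ → ρCtx Γ ⊢ ρCtx Δ
    ⊢-rename (node r Γ₀ Δ₀ Γ↭ Δ↭ sideΓ sideΔ prems) =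
      let pˡ , pʳ , sˡ , sʳ = ρRule-conclusion r in
      node (ρRule r) (ρCtx Γ₀) (ρCtx Δ₀)
        (subst (λ Θ → _ ↭ Θ ++ ρCtx Γ₀) (≡.sym pˡ) (ρ-↭ (principalˡ r) Γ↭))
        (subst (λ Θ → _ ↭ Θ ++ ρCtx Δ₀) (≡.sym pʳ) (ρ-↭ (principalʳ r) Δ↭))
        (subst (All (_∈ ρCtx Γ₀)) (≡.sym sˡ) (ρ-∈ sideΓ))
        (subst (All (_∈ ρCtx Δ₀)) (≡.sym sʳ) (ρ-∈ sideΔ))
        λ i → let eqˡ , eqʳ = ρRule-premise r i in
          subst₂ (λ Θ Ξ → Θ ++ ρCtx Γ₀ ⊢ Ξ ++ ρCtx Δ₀) (≡.sym eqˡ) (≡.sym eqʳ)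
            (subst₂ _⊢_ (map-++ ρItem _ Γ₀) (map-++ ρItem _ Δ₀) (⊢-rename (prems (ρBranch r i))))

    ρCtx-fresh : ∀ Γ → u ∉ labels Γ → ρCtx Γ ≡ Γ
    ρCtx-fresh []              _  = refl
    ρCtx-fresh (rel x a y ∷ Γ) u∉ =
      cong₂ _∷_ (cong₂ (λ x' y' → rel x' a y') (ρ-≢ (u∉ ∘ here ∘ ≡.sym)) (ρ-≢ (u∉ ∘ there ∘ here ∘ ≡.sym)))
                (ρCtx-fresh Γ (u∉ ∘ there ∘ there))
    ρCtx-fresh (lab x F ∷ Γ)   u∉ =
      cong₂ _∷_ (cong (λ x' → lab x' F) (ρ-≢ (u∉ ∘ here ∘ ≡.sym))) (ρCtx-fresh Γ (u∉ ∘ there))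

  ⊢-instantiate : ∀ {y₀} → y₀ ≢ x → y₀ ∉ labels Γ → y₀ ∉ labels Δ
    → rel x a y₀ ∷ Γ ⊢ lab y₀ φ ∷ Δ → ∀ y → rel x a y ∷ Γ ⊢ lab y φ ∷ Δ
  ⊢-instantiate {Γ = Γ} {Δ = Δ} {y₀ = y₀} y₀≢x y₀∉Γ y₀∉Δ d y =
    subst₂ _⊢_
      (cong₂ _∷_ (cong₂ (λ x' y' → rel x' _ y') (ρ-≢ (y₀≢x ∘ ≡.sym)) ρ-u) (ρCtx-fresh Γ y₀∉Γ))
      (cong₂ _∷_ (cong (λ y' → lab y' _) ρ-u) (ρCtx-fresh Δ y₀∉Δ))
      (⊢-rename d)
    where open Renaming y₀ y

  -- Replacement and inversion

  ∈⇒↭∷ : it ∈ Γ → ∃ λ Γ' → Γ ↭ it ∷ Γ'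
  ∈⇒↭∷ it∈Γ with ∈-∃++ it∈Γ
  ... | Γ₁ , Γ₂ , refl = Γ₁ ++ Γ₂ , shift _ Γ₁ Γ₂

  All-∈-∷⁻ : All (_∈ it ∷ Γ) Θ → All (_∈ Γ) Θ ⊎ it ∈ Θ
  All-∈-∷⁻ []                = inj₁ []
  All-∈-∷⁻ (here refl ∷ _)   = inj₂ (here refl)
  All-∈-∷⁻ (there m ∷ all) with All-∈-∷⁻ all
  ... | inj₁ all' = inj₁ (m ∷ all')
  ... | inj₂ it∈Θ = inj₂ (there it∈Θ)

  ∈-∷-absorb : ∀ {it'} → it ∈ Γ → it' ∈ it ∷ Γ → it' ∈ Γ
  ∈-∷-absorb it∈Γ (here refl) = it∈Γ
  ∈-∷-absorb _    (there m)   = m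

  ↭-remove : ∀ {Γ₁ Γ₂} → Γ ↭ it ∷ X → Γ ↭ Θ ++ Γ₁ → Γ₁ ↭ it ∷ Γ₂ → X ↭ Θ ++ Γ₂
  ↭-remove {it = it} {Θ = Θ} {Γ₂ = Γ₂} Γ↭it∷X Γ↭Θ++Γ₁ Γ₁↭ =
    drop-∷ (↭-trans (↭-sym Γ↭it∷X) (↭-trans Γ↭Θ++Γ₁ (↭-trans (++⁺ˡ Θ Γ₁↭) (shift it Θ Γ₂))))

  -- What replacing an item C by A on the left and B on the right requires at the rule instances where C is
  -- principal, resp. a side item; at all other rule instances the replacement is structural.
  ReplacePrincipalˡ ReplaceSideˡ ReplacePrincipalʳ ReplaceSideʳ : Item → Ctx → Ctx → Set
  ReplacePrincipalˡ C A B = ∀ {r Γ₀ Δ₀ X} → C ∈ principalˡ r → C ∷ X ↭ principalˡ r ++ Γ₀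
    → All (_∈ Γ₀) (sideˡ r) → All (_∈ Δ₀) (sideʳ r)
    → (∀ i → premiseˡ r i ++ Γ₀ ⊢ premiseʳ r i ++ Δ₀) → A ++ X ⊢ B ++ principalʳ r ++ Δ₀
  ReplaceSideˡ C A B = ∀ {r Γ₀ Δ₀} → C ∈ sideˡ r → All (_∈ C ∷ Γ₀) (sideˡ r) → All (_∈ Δ₀) (sideʳ r)
    → (∀ i → A ++ premiseˡ r i ++ Γ₀ ⊢ B ++ premiseʳ r i ++ Δ₀)
    → A ++ principalˡ r ++ Γ₀ ⊢ B ++ principalʳ r ++ Δ₀
  ReplacePrincipalʳ C A B = ∀ {r Γ₀ Δ₀ Y} → C ∈ principalʳ r → C ∷ Y ↭ principalʳ r ++ Δ₀
    → All (_∈ Γ₀) (sideˡ r) → All (_∈ Δ₀) (sideʳ r)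
    → (∀ i → premiseˡ r i ++ Γ₀ ⊢ premiseʳ r i ++ Δ₀) → A ++ principalˡ r ++ Γ₀ ⊢ B ++ Y
  ReplaceSideʳ C A B = ∀ {r Γ₀ Δ₀} → C ∈ sideʳ r → All (_∈ Γ₀) (sideˡ r) → All (_∈ C ∷ Δ₀) (sideʳ r)
    → (∀ i → A ++ premiseˡ r i ++ Γ₀ ⊢ B ++ premiseʳ r i ++ Δ₀)
    → A ++ principalˡ r ++ Γ₀ ⊢ B ++ principalʳ r ++ Δ₀

  replaceˡ : ∀ {C A B} → ReplacePrincipalˡ C A B → ReplaceSideˡ C A B
    → Γ ⊢ Δ → Γ ↭ C ∷ X → A ++ X ⊢ B ++ Δ
  replaceˡ {Δ = Δ} {X = X} {C = C} {A} {B} onPrincipal onSide (node r Γ₀ Δ₀ Γ↭ Δ↭ sideΓ sideΔ prems) Γ↭C∷X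
    with ∈-++⁻ (principalˡ r) (∈-resp-↭ (↭-trans (↭-sym Γ↭C∷X) Γ↭) (here refl))
  ... | inj₁ C∈principal =
    ⊢-exchʳ (++⁺ˡ B (↭-sym Δ↭)) (onPrincipal C∈principal (↭-trans (↭-sym Γ↭C∷X) Γ↭) sideΓ sideΔ prems)
  ... | inj₂ C∈Γ₀ with ∈⇒↭∷ C∈Γ₀
  ...   | Γ₁ , Γ₀↭C∷Γ₁ = rebuild (All-∈-∷⁻ (All.map (∈-resp-↭ Γ₀↭C∷Γ₁) sideΓ))
    where
    X↭ : X ↭ principalˡ r ++ Γ₁
    X↭ = ↭-remove Γ↭C∷X Γ↭ Γ₀↭C∷Γ₁
    replaced : ∀ i → A ++ premiseˡ r i ++ Γ₁ ⊢ B ++ premiseʳ r i ++ Δ₀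
    replaced i = replaceˡ {C = C} {A} {B} onPrincipal onSide (prems i)
      (↭-trans (++⁺ˡ (premiseˡ r i) Γ₀↭C∷Γ₁) (shift C (premiseˡ r i) Γ₁))
    rebuild : All (_∈ Γ₁) (sideˡ r) ⊎ C ∈ sideˡ r → A ++ X ⊢ B ++ Δ
    rebuild (inj₁ sideΓ₁) =
      node r (A ++ Γ₁) (B ++ Δ₀)
        (↭-trans (++⁺ˡ A X↭) (shifts A (principalˡ r))) (↭-trans (++⁺ˡ B Δ↭) (shifts B (principalʳ r)))
        (All.map (∈-++⁺ʳ A) sideΓ₁) (All.map (∈-++⁺ʳ B) sideΔ)
        (λ i → ⊢-exch (shifts A (premiseˡ r i)) (shifts B (premiseʳ r i)) (replaced i))
    rebuild (inj₂ C∈side) =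
      ⊢-exch (↭-sym (++⁺ˡ A X↭)) (++⁺ˡ B (↭-sym Δ↭))
        (onSide C∈side (All.map (∈-resp-↭ Γ₀↭C∷Γ₁) sideΓ) sideΔ replaced)

  replaceʳ : ∀ {C A B} → ReplacePrincipalʳ C A B → ReplaceSideʳ C A B
    → Γ ⊢ Δ → Δ ↭ C ∷ Y → A ++ Γ ⊢ B ++ Y
  replaceʳ {Γ = Γ} {Y = Y} {C = C} {A} {B} onPrincipal onSide (node r Γ₀ Δ₀ Γ↭ Δ↭ sideΓ sideΔ prems) Δ↭C∷Y
    with ∈-++⁻ (principalʳ r) (∈-resp-↭ (↭-trans (↭-sym Δ↭C∷Y) Δ↭) (here refl))
  ... | inj₁ C∈principal =
    ⊢-exchˡ (++⁺ˡ A (↭-sym Γ↭)) (onPrincipal C∈principal (↭-trans (↭-sym Δ↭C∷Y) Δ↭) sideΓ sideΔ prems)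
  ... | inj₂ C∈Δ₀ with ∈⇒↭∷ C∈Δ₀
  ...   | Δ₁ , Δ₀↭C∷Δ₁ = rebuild (All-∈-∷⁻ (All.map (∈-resp-↭ Δ₀↭C∷Δ₁) sideΔ))
    where
    Y↭ : Y ↭ principalʳ r ++ Δ₁
    Y↭ = ↭-remove Δ↭C∷Y Δ↭ Δ₀↭C∷Δ₁
    replaced : ∀ i → A ++ premiseˡ r i ++ Γ₀ ⊢ B ++ premiseʳ r i ++ Δ₁
    replaced i = replaceʳ {C = C} {A} {B} onPrincipal onSide (prems i)
      (↭-trans (++⁺ˡ (premiseʳ r i) Δ₀↭C∷Δ₁) (shift C (premiseʳ r i) Δ₁))
    rebuild : All (_∈ Δ₁) (sideʳ r) ⊎ C ∈ sideʳ r → A ++ Γ ⊢ B ++ Y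
    rebuild (inj₁ sideΔ₁) =
      node r (A ++ Γ₀) (B ++ Δ₁)
        (↭-trans (++⁺ˡ A Γ↭) (shifts A (principalˡ r))) (↭-trans (++⁺ˡ B Y↭) (shifts B (principalʳ r)))
        (All.map (∈-++⁺ʳ A) sideΓ) (All.map (∈-++⁺ʳ B) sideΔ₁)
        (λ i → ⊢-exch (shifts A (premiseˡ r i)) (shifts B (premiseʳ r i)) (replaced i))
    rebuild (inj₂ C∈side) =
      ⊢-exch (++⁺ˡ A (↭-sym Γ↭)) (↭-sym (++⁺ˡ B Y↭))
        (onSide C∈side sideΓ (All.map (∈-resp-↭ Δ₀↭C∷Δ₁) sideΔ) replaced)

  invertˡ : lab x F ∷ X ⊢ Y → ∀ i
    → labs x (L-premiseˡ (kind F) i) ++ X ⊢ labs x (L-premiseʳ (kind F) i) ++ Y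
  invertˡ {x = x} {F = F} d i = replaceˡ onPrincipal onSide d ↭-refl
    where
    A B : Ctx
    A = labs x (L-premiseˡ (kind F) i)
    B = labs x (L-premiseʳ (kind F) i)
    onPrincipal : ReplacePrincipalˡ (lab x F) A B
    onPrincipal {r} m C∷X↭ _ _ prems with principalˡ-view r m
    ... | compL _ = ⊢-exchˡ (++⁺ˡ _ (↭-sym (drop-∷ C∷X↭))) (prems i)
    onSide : ReplaceSideˡ (lab x F) A B
    onSide {r} m _ _ _ with lab-sideˡ-view r m
    ... | axP  = ⊥-elim i
    ... | boxL = ⊥-elim i

  invertʳ : X ⊢ lab x F ∷ Y → ∀ i
    → labs x (R-premiseˡ (kind F) i) ++ X ⊢ labs x (R-premiseʳ (kind F) i) ++ Y
  invertʳ {x = x} {F = F} d i = replaceʳ onPrincipal onSide d ↭-refl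
    where
    A B : Ctx
    A = labs x (R-premiseˡ (kind F) i)
    B = labs x (R-premiseʳ (kind F) i)
    onPrincipal : ReplacePrincipalʳ (lab x F) A B
    onPrincipal {r} m C∷Y↭ _ _ prems with principalʳ-view r m
    ... | compR _  = ⊢-exchʳ (++⁺ˡ _ (↭-sym (drop-∷ C∷Y↭))) (prems i)
    ... | boxR _   = ⊥-elim i
    onSide : ReplaceSideʳ (lab x F) A B
    onSide {r} m _ _ _ with lab-sideʳ-view r m
    ... | axP = ⊥-elim i

  invertK : X ⊢ lab x (K a φ) ∷ Y → ∀ y → rel x a y ∷ X ⊢ lab y φ ∷ Y
  invertK {x = x} {a = a} {φ = φ} d y = replaceʳ onPrincipal onSide d ↭-refl
    where
    onPrincipal : ReplacePrincipalʳ (lab x (K a φ)) (rel x a y ∷ []) (lab y φ ∷ [])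
    onPrincipal {r} m C∷Y↭ _ _ prems with principalʳ-view r m
    ... | compR ()
    -- K-right has premises only at labels outside `used`: instantiate a fresh one to y.
    onPrincipal {Γ₀ = Γ₀} {Δ₀} m C∷Y↭ _ _ prems | boxR used
      with y₀ , y₀∉ ← fresh (used ++ x ∷ labels Γ₀ ++ labels Δ₀) =
      ⊢-exchʳ (prep _ (↭-sym (drop-∷ C∷Y↭)))
        (⊢-instantiate (y₀∉ ∘ ∈-++⁺ʳ used ∘ here) (y₀∉ ∘ ∈-++⁺ʳ used ∘ there ∘ ∈-++⁺ˡ)
          (y₀∉ ∘ ∈-++⁺ʳ used ∘ there ∘ ∈-++⁺ʳ (labels Γ₀)) (prems (y₀ , y₀∉ ∘ ∈-++⁺ˡ)) y)
    onSide : ReplaceSideʳ (lab x (K a φ)) (rel x a y ∷ []) (lab y φ ∷ [])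
    onSide {r} m _ _ _ with lab-sideʳ-view r m
    ... | ()

  -- Contraction

  contract-nonprincipalˡ : (∀ r → it ∉ principalˡ r) → Γ ⊢ Δ → Γ ↭ it ∷ X → it ∈ X → X ⊢ Δ
  contract-nonprincipalˡ notPrincipal (node r Γ₀ Δ₀ Γ↭ Δ↭ sideΓ sideΔ prems) Γ↭C∷X C∈X
    with ∈-++⁻ (principalˡ r) (∈-resp-↭ (↭-trans (↭-sym Γ↭C∷X) Γ↭) (here refl))
  ... | inj₁ C∈principal = ⊥-elim (notPrincipal r C∈principal)
  ... | inj₂ C∈Γ₀ with ∈⇒↭∷ C∈Γ₀
  ...   | Γ₁ , Γ₀↭C∷Γ₁ with ∈-++⁻ (principalˡ r) (∈-resp-↭ (↭-remove Γ↭C∷X Γ↭ Γ₀↭C∷Γ₁) C∈X)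
  ...     | inj₁ C∈principal = ⊥-elim (notPrincipal r C∈principal)
  ...     | inj₂ C∈Γ₁ =
    node r Γ₁ Δ₀ (↭-remove Γ↭C∷X Γ↭ Γ₀↭C∷Γ₁) Δ↭ (All.map (∈-∷-absorb C∈Γ₁ ∘ ∈-resp-↭ Γ₀↭C∷Γ₁) sideΓ) sideΔ
      (λ i → contract-nonprincipalˡ notPrincipal (prems i)
               (↭-trans (++⁺ˡ (premiseˡ r i) Γ₀↭C∷Γ₁) (shift _ (premiseˡ r i) Γ₁))
               (∈-++⁺ʳ (premiseˡ r i) C∈Γ₁))

  contract-nonprincipalʳ : (∀ r → it ∉ principalʳ r) → Γ ⊢ Δ → Δ ↭ it ∷ Y → it ∈ Y → Γ ⊢ Y
  contract-nonprincipalʳ notPrincipal (node r Γ₀ Δ₀ Γ↭ Δ↭ sideΓ sideΔ prems) Δ↭C∷Y C∈Y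
    with ∈-++⁻ (principalʳ r) (∈-resp-↭ (↭-trans (↭-sym Δ↭C∷Y) Δ↭) (here refl))
  ... | inj₁ C∈principal = ⊥-elim (notPrincipal r C∈principal)
  ... | inj₂ C∈Δ₀ with ∈⇒↭∷ C∈Δ₀
  ...   | Δ₁ , Δ₀↭C∷Δ₁ with ∈-++⁻ (principalʳ r) (∈-resp-↭ (↭-remove Δ↭C∷Y Δ↭ Δ₀↭C∷Δ₁) C∈Y)
  ...     | inj₁ C∈principal = ⊥-elim (notPrincipal r C∈principal)
  ...     | inj₂ C∈Δ₁ =
    node r Γ₀ Δ₁ Γ↭ (↭-remove Δ↭C∷Y Δ↭ Δ₀↭C∷Δ₁) sideΓ (All.map (∈-∷-absorb C∈Δ₁ ∘ ∈-resp-↭ Δ₀↭C∷Δ₁) sideΔ)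
      (λ i → contract-nonprincipalʳ notPrincipal (prems i)
               (↭-trans (++⁺ˡ (premiseʳ r i) Δ₀↭C∷Δ₁) (shift _ (premiseʳ r i) Δ₁))
               (∈-++⁺ʳ (premiseʳ r i) C∈Δ₁))

  Contractibleˡ Contractibleʳ : Item → Set
  Contractibleˡ it = ∀ {X Y} → it ∷ it ∷ X ⊢ Y → it ∷ X ⊢ Y
  Contractibleʳ it = ∀ {X Y} → X ⊢ it ∷ it ∷ Y → X ⊢ it ∷ Y

  contract-++ˡ : ∀ Θ → All Contractibleˡ Θ → Θ ++ Θ ++ X ⊢ Y → Θ ++ X ⊢ Y
  contract-++ˡ []      []                 d = d
  contract-++ˡ {X = X} (it ∷ Θ) (contract ∷ cs) d =
    ⊢-exchˡ (shift it Θ X)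
      (contract-++ˡ Θ cs (⊢-exchˡ (↭-trans (↭-sym (shift it Θ (Θ ++ X))) (++⁺ˡ Θ (↭-sym (shift it Θ X))))
        (contract (⊢-exchˡ (prep it (shift it Θ (Θ ++ X))) d))))

  contract-++ʳ : ∀ Θ → All Contractibleʳ Θ → X ⊢ Θ ++ Θ ++ Y → X ⊢ Θ ++ Y
  contract-++ʳ []      []                 d = d
  contract-++ʳ {Y = Y} (it ∷ Θ) (contract ∷ cs) d =
    ⊢-exchʳ (shift it Θ Y)
      (contract-++ʳ Θ cs (⊢-exchʳ (↭-trans (↭-sym (shift it Θ (Θ ++ Y))) (++⁺ˡ Θ (↭-sym (shift it Θ Y))))
        (contract (⊢-exchʳ (prep it (shift it Θ (Θ ++ Y))) d))))

  contract-relˡ : ∀ {z} → Contractibleˡ (rel x a z)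
  contract-relˡ d = contract-nonprincipalˡ rel∉principalˡ d ↭-refl (here refl)

  contract-relʳ : ∀ {z} → Contractibleʳ (rel x a z)
  contract-relʳ d = contract-nonprincipalʳ rel∉principalʳ d ↭-refl (here refl)

  components-below : ∀ {N} → weight F < suc N → All (Lighter N) (components (kind F))
  components-below {F = F} lt = All.map (λ h → <-≤-trans h (s≤s⁻¹ lt)) (components-lighter F)

  All-labs : ∀ {P : Fm → Set} {Q : Item → Set} {fs}
    → (∀ {G} → P G → Q (lab x G)) → All P fs → All Q (labs x fs)
  All-labs f = All-map⁺ ∘ All.map f

  contractˡ-< : ∀ N → weight F < N → Contractibleˡ (lab x F)
  contractʳ-< : ∀ N → weight F < N → Contractibleʳ (lab x F)

  contractˡ-< {F = F} {x = x} (suc N) lt {X} {Y} d with shape F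
  ... | atomic p   = contract-nonprincipalˡ var∉principalˡ d ↭-refl (here refl)
  ... | modal a φ  = contract-nonprincipalˡ K∉principalˡ d ↭-refl (here refl)
  ... | compound p = node (compL x F p) X Y ↭-refl ↭-refl [] [] premise
    where
    premise : ∀ i → labs x (L-premiseˡ (kind F) i) ++ X ⊢ labs x (L-premiseʳ (kind F) i) ++ Y
    premise i =
      contract-++ʳ _ (All-labs (contractʳ-< N) (All-L-premiseʳ (kind F) i (components-below lt)))
        (contract-++ˡ _ (All-labs (contractˡ-< N) (All-L-premiseˡ (kind F) i (components-below lt)))
          (invertˡ (⊢-exchˡ (shift _ (labs x (L-premiseˡ (kind F) i)) X) (invertˡ d i)) i))

  contractʳ-< {F = F} {x = x} (suc N) lt {X} {Y} d with shape F
  ... | atomic p   = contract-nonprincipalʳ var∉principalʳ d ↭-refl (here refl)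
  ... | modal a φ  = node (boxR x a φ []) X Y ↭-refl ↭-refl [] [] premise
    where
    premise : ((y , _) : ∃ λ y → y ∉ []) → rel x a y ∷ X ⊢ lab y φ ∷ Y
    premise (y , _) =
      contractʳ-< N (s≤s⁻¹ lt) (contract-relˡ (invertK (⊢-exchʳ (swap _ _ ↭-refl) (invertK d y)) y))
  ... | compound p = node (compR x F p) X Y ↭-refl ↭-refl [] [] premise
    where
    premise : ∀ i → labs x (R-premiseˡ (kind F) i) ++ X ⊢ labs x (R-premiseʳ (kind F) i) ++ Y
    premise i =
      contract-++ʳ _ (All-labs (contractʳ-< N) (All-R-premiseʳ (kind F) i (components-below lt)))
        (contract-++ˡ _ (All-labs (contractˡ-< N) (All-R-premiseˡ (kind F) i (components-below lt)))
          (invertʳ (⊢-exchʳ (shift _ (labs x (R-premiseʳ (kind F) i)) Y) (invertʳ d i)) i))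

  contractˡ : ∀ it → Contractibleˡ it
  contractˡ (lab x F)   = contractˡ-< (suc (weight F)) (n<1+n _)
  contractˡ (rel x a y) = contract-relˡ

  contractʳ : ∀ it → Contractibleʳ it
  contractʳ (lab x F)   = contractʳ-< (suc (weight F)) (n<1+n _)
  contractʳ (rel x a y) = contract-relʳ

  contract-ctxˡ : ∀ Θ → Θ ++ Θ ++ X ⊢ Y → Θ ++ X ⊢ Y
  contract-ctxˡ Θ = contract-++ˡ Θ (All.universal contractˡ Θ)

  contract-ctxʳ : ∀ Θ → X ⊢ Θ ++ Θ ++ Y → X ⊢ Θ ++ Y
  contract-ctxʳ Θ = contract-++ʳ Θ (All.universal contractʳ Θ)

  -- Cut

  CutAt : Fm → Set
  CutAt A = ∀ {x Γ Δ Γ' Δ'} → Γ ⊢ lab x A ∷ Δ → lab x A ∷ Γ' ⊢ Δ' → Γ ++ Γ' ⊢ Δ ++ Δ'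

  -- Initial sequents with the atom as side formula contain it on the left too; they become weakenings of d₂.
  cut-var : ∀ {p} → CutAt (var p)
  cut-var {p} {x} {Γ} {Δ} {Γ'} {Δ'} d₁ d₂ =
    ⊢-exch (++-comm Γ' Γ) (++-comm Δ' Δ) (replaceʳ onPrincipal onSide d₁ ↭-refl)
    where
    onPrincipal : ReplacePrincipalʳ (lab x (var p)) Γ' Δ'
    onPrincipal {r} m _ _ _ _ = ⊥-elim (var∉principalʳ r m)
    onSide : ReplaceSideʳ (lab x (var p)) Γ' Δ'
    onSide {r} m _ _ _ with lab-sideʳ-view r m
    onSide {Γ₀ = Γ₀} {Δ₀} m (p∈Γ₀ ∷ []) _ _ | axP with Γ₁ , Γ₀↭p∷Γ₁ ← ∈⇒↭∷ p∈Γ₀ =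
      ⊢-exch (↭-trans (shift _ Γ₁ Γ') (↭-trans (++⁺ʳ Γ' (↭-sym Γ₀↭p∷Γ₁)) (++-comm Γ₀ Γ'))) (++-comm Δ₀ Δ')
        (⊢-weaken Γ₁ Δ₀ d₂)

  -- At K-left the boxed formula gives way to a cut with the instance of d₁ at the accessible label.
  cut-K : CutAt φ → CutAt (K a φ)
  cut-K {φ} {a} cutφ {x} {Γ} {Δ} {Γ'} {Δ'} d₁ d₂ = replaceˡ onPrincipal onSide d₂ ↭-refl
    where
    onPrincipal : ReplacePrincipalˡ (lab x (K a φ)) Γ Δ
    onPrincipal {r} m _ _ _ _ = ⊥-elim (K∉principalˡ r m)
    onSide : ReplaceSideˡ (lab x (K a φ)) Γ Δ
    onSide {r} m _ _ _ with lab-sideˡ-view r m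
    onSide {Γ₀ = Γ₀} m (_ ∷ there xy∈Γ₀ ∷ []) _ prems | boxL {y = y} =
      contract-ctxʳ Δ
        (contract-nonprincipalˡ rel∉principalˡ
          (contract-ctxˡ Γ
            (⊢-exchˡ (↭-trans (↭-sym (shift _ Γ (Γ ++ Γ₀))) (++⁺ˡ Γ (↭-sym (shift _ Γ Γ₀))))
              (cutφ (invertK d₁ y) (⊢-exchˡ (shift _ Γ Γ₀) (prems tt)))))
          (shift _ Γ Γ₀) (∈-++⁺ʳ Γ xy∈Γ₀))

  cut-compound : Compound (kind F) → (∀ {G} → weight G < weight F → CutAt G) → CutAt F
  cut-compound {F = F} p cutBelow {x} {Γ} {Δ} {Γ'} {Δ'} d₁ d₂ =
    cut-kind (kind F) p (components-lighter F) (invertʳ d₁) (invertˡ d₂)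
    where
    cut-kind : ∀ k → Compound k → All (Lighter (weight F)) (components k)
      → (∀ i → labs x (R-premiseˡ k i) ++ Γ ⊢ labs x (R-premiseʳ k i) ++ Δ)
      → (∀ i → labs x (L-premiseˡ k i) ++ Γ' ⊢ labs x (L-premiseʳ k i) ++ Δ')
      → Γ ++ Γ' ⊢ Δ ++ Δ'
    cut-kind (neg A) _ (A< ∷ []) right left =
      ⊢-exch (++-comm Γ' Γ) (++-comm Δ' Δ) (cutBelow A< (left tt) (right tt))
    cut-kind (conj A B) _ (A< ∷ B< ∷ []) right left =
      contract-ctxʳ Δ (contract-ctxˡ Γ
        (cutBelow A< (right true)
          (⊢-exchˡ (shift _ Γ Γ') (cutBelow B< (right false) (⊢-exchˡ (swap _ _ ↭-refl) (left tt))))))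
    cut-kind (imp A B) _ (A< ∷ B< ∷ []) right left =
      ⊢-exch (++-comm Γ' Γ) (++-comm Δ' Δ) (contract-ctxʳ Δ' (contract-ctxˡ Γ'
        (⊢-exch (++-comm (Γ' ++ Γ) Γ') (++-comm (Δ' ++ Δ) Δ')
          (cutBelow B< (⊢-exchʳ (shift _ Δ' Δ) (cutBelow A< (left true) (right tt))) (left false)))))
    cut-kind (unfold A) _ (A< ∷ []) right left = cutBelow A< (right tt) (left tt)

  cut-< : ∀ N → weight F < N → CutAt F
  cut-< {F = F} (suc N) lt with shape F
  ... | atomic p   = cut-var
  ... | modal a φ  = cut-K (cut-< N (s≤s⁻¹ lt))
  ... | compound p = cut-compound p (λ lighter → cut-< N (<-≤-trans lighter (s≤s⁻¹ lt)))

  cut : CutAt F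
  cut {F = F} = cut-< (suc (weight F)) (n<1+n _)

  -- Equivalence with G_PAL

  ⊢-lastʳ : Γ ⊢ Δ ++ it ∷ [] → Γ ⊢ it ∷ Δ
  ⊢-lastʳ {Δ = Δ} = ⊢-exchʳ (++-comm Δ _)

  ⇒-lastʳ : Γ ⇒ it ∷ Δ → Γ ⇒ Δ ++ it ∷ []
  ⇒-lastʳ {Δ = Δ} = exch ↭-refl (++-comm (_ ∷ []) Δ)

  ⇒-firstʳ : Γ ⇒ Δ ++ it ∷ [] → Γ ⇒ it ∷ Δ
  ⇒-firstʳ {Δ = Δ} = exch ↭-refl (++-comm Δ (_ ∷ []))

  labels-++ : ∀ Γ Δ → labels (Γ ++ Δ) ≡ labels Γ ++ labels Δ
  labels-++ []      Δ = refl
  labels-++ (i ∷ Γ) Δ =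
    ≡.trans (cong (labelsI i ++_) (labels-++ Γ Δ)) (≡.sym (++-assoc-≡ (labelsI i) (labels Γ) (labels Δ)))

  ∉-labels-++ : ∀ Γ Δ → y ∉ labels (Γ ++ Δ) → y ∉ labels Γ × y ∉ labels Δ
  ∉-labels-++ {y = y} Γ Δ y∉ =
    (y∉ ∘ subst (y ∈_) (≡.sym (labels-++ Γ Δ)) ∘ ∈-++⁺ˡ) ,
    (y∉ ∘ subst (y ∈_) (≡.sym (labels-++ Γ Δ)) ∘ ∈-++⁺ʳ (labels Γ))

  compL-node : (p : Compound (kind F))
    → (∀ i → labs x (L-premiseˡ (kind F) i) ++ Γ ⊢ labs x (L-premiseʳ (kind F) i) ++ Δ) → lab x F ∷ Γ ⊢ Δ
  compL-node {F = F} {x = x} {Γ = Γ} {Δ = Δ} p = node (compL x F p) Γ Δ ↭-refl ↭-refl [] []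

  compR-node : (p : Compound (kind F))
    → (∀ i → labs x (R-premiseˡ (kind F) i) ++ Γ ⊢ labs x (R-premiseʳ (kind F) i) ++ Δ)
    → Γ ⊢ Δ ++ lab x F ∷ []
  compR-node {F = F} {x = x} {Γ = Γ} {Δ = Δ} p = node (compR x F p) Γ Δ ↭-refl (++-comm Δ _) [] []

  ⊢-complete : Γ ⇒ Δ → Γ ⊢ Δ
  ⊢-complete (exch Γ↭ Δ↭ d) = ⊢-exch Γ↭ Δ↭ (⊢-complete d)
  ⊢-complete (initP {x} {p} {Γ} {Δ}) =
    node (axP x p) (lab x (var p) ∷ Γ) (Δ ++ lab x (var p) ∷ []) ↭-refl ↭-refl
      (here refl ∷ []) (∈-++⁺ʳ Δ (here refl) ∷ []) λ ()
  ⊢-complete (initR {x} {a} {y} {Γ} {Δ}) =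
    node (axR x a y) (rel x a y ∷ Γ) (Δ ++ rel x a y ∷ []) ↭-refl ↭-refl
      (here refl ∷ []) (∈-++⁺ʳ Δ (here refl) ∷ []) λ ()
  ⊢-complete (¬L d)      = compL-node tt λ _ → ⊢-lastʳ (⊢-complete d)
  ⊢-complete (¬R d)      = compR-node tt λ _ → ⊢-complete d
  ⊢-complete (∧L d)      = compL-node tt λ _ → ⊢-complete d
  ⊢-complete (∧R d₁ d₂)  =
    compR-node tt λ { true → ⊢-lastʳ (⊢-complete d₁) ; false → ⊢-lastʳ (⊢-complete d₂) }
  ⊢-complete (→L d₁ d₂)  = compL-node tt λ { true → ⊢-lastʳ (⊢-complete d₁) ; false → ⊢-complete d₂ }
  ⊢-complete (→R d)      = compR-node tt λ _ → ⊢-lastʳ (⊢-complete d)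
  ⊢-complete (KL {x} {y} {a} {φ} {Γ} {Δ} d) =
    node (boxL x a φ y) (lab x (K a φ) ∷ rel x a y ∷ Γ) Δ ↭-refl ↭-refl
      (here refl ∷ there (here refl) ∷ []) [] λ _ → ⊢-complete d
  ⊢-complete (KR {x} {y} {a} {φ} {Γ} {Δ} y∉ y≢x d) =
    let y∉Γ , y∉Δ = ∉-labels-++ Γ Δ y∉ in
    node (boxR x a φ []) Γ Δ ↭-refl (++-comm Δ _) [] []
      λ (z , _) → ⊢-instantiate y≢x y∉Γ y∉Δ (⊢-lastʳ (⊢-complete d)) z
  ⊢-complete (Ref {x} {a} {Γ} {Δ} d) = node (reflexivity x a) Γ Δ ↭-refl ↭-refl [] [] λ _ → ⊢-complete d
  ⊢-complete (Trans {x} {y} {z} {a} {Γ} {Δ} d) =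
    node (transitivity x y z a) (rel x a y ∷ rel y a z ∷ Γ) Δ ↭-refl ↭-refl
      (here refl ∷ there (here refl) ∷ []) [] λ _ → ⊢-complete d
  ⊢-complete (Sym {x} {y} {a} {Γ} {Δ} d) =
    node (symmetry x y a) (rel x a y ∷ Γ) Δ ↭-refl ↭-refl (here refl ∷ []) [] λ _ → ⊢-complete d
  ⊢-complete (R1L d₁ d₂) = compL-node tt λ { true → ⊢-lastʳ (⊢-complete d₁) ; false → ⊢-complete d₂ }
  ⊢-complete (R1R d)     = compR-node tt λ _ → ⊢-lastʳ (⊢-complete d)
  ⊢-complete (R2L d₁ d₂) = compL-node tt λ { true → ⊢-lastʳ (⊢-complete d₁) ; false → ⊢-complete d₂ }
  ⊢-complete (R2R d)     = compR-node tt λ _ → ⊢-lastʳ (⊢-complete d)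
  ⊢-complete (R3L d)     = compL-node tt λ _ → ⊢-complete d
  ⊢-complete (R3R d₁ d₂) =
    compR-node tt λ { true → ⊢-lastʳ (⊢-complete d₁) ; false → ⊢-lastʳ (⊢-complete d₂) }
  ⊢-complete (R4L d₁ d₂) = compL-node tt λ { true → ⊢-lastʳ (⊢-complete d₁) ; false → ⊢-complete d₂ }
  ⊢-complete (R4R d)     = compR-node tt λ _ → ⊢-lastʳ (⊢-complete d)
  ⊢-complete (R5L d₁ d₂) = compL-node tt λ { true → ⊢-lastʳ (⊢-complete d₁) ; false → ⊢-complete d₂ }
  ⊢-complete (R5R d)     = compR-node tt λ _ → ⊢-lastʳ (⊢-complete d)
  ⊢-complete (R6L d)     = compL-node tt λ _ → ⊢-complete d
  ⊢-complete (R6R d)     = compR-node tt λ _ → ⊢-lastʳ (⊢-complete d)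

  compL-sound : ∀ x F → Compound (kind F)
    → (∀ i → labs x (L-premiseˡ (kind F) i) ++ Γ ⇒ labs x (L-premiseʳ (kind F) i) ++ Δ) → lab x F ∷ Γ ⇒ Δ
  compL-sound x (var p)            ()
  compL-sound x (K a φ)            ()
  compL-sound x (¬' φ)             _ prems = ¬L (⇒-lastʳ (prems tt))
  compL-sound x (φ ∧' ψ)           _ prems = ∧L (prems tt)
  compL-sound x (φ →' ψ)           _ prems = →L (⇒-lastʳ (prems true)) (prems false)
  compL-sound x ([ φ ] var p)      _ prems = R1L (⇒-lastʳ (prems true)) (prems false)
  compL-sound x ([ φ ] (¬' ψ))     _ prems = R2L (⇒-lastʳ (prems true)) (prems false)
  compL-sound x ([ φ ] (ψ₁ ∧' ψ₂)) _ prems = R3L (prems tt)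
  compL-sound x ([ φ ] (ψ₁ →' ψ₂)) _ prems = R4L (⇒-lastʳ (prems true)) (prems false)
  compL-sound x ([ φ ] K a ψ)      _ prems = R5L (⇒-lastʳ (prems true)) (prems false)
  compL-sound x ([ φ ] ([ ψ ] χ))  _ prems = R6L (prems tt)

  compR-sound : ∀ x F → Compound (kind F)
    → (∀ i → labs x (R-premiseˡ (kind F) i) ++ Γ ⇒ labs x (R-premiseʳ (kind F) i) ++ Δ) → Γ ⇒ lab x F ∷ Δ
  compR-sound x (var p)            ()
  compR-sound x (K a φ)            ()
  compR-sound x (¬' φ)             _ prems = ⇒-firstʳ (¬R (prems tt))
  compR-sound x (φ ∧' ψ)           _ prems = ⇒-firstʳ (∧R (⇒-lastʳ (prems true)) (⇒-lastʳ (prems false)))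
  compR-sound x (φ →' ψ)           _ prems = ⇒-firstʳ (→R (⇒-lastʳ (prems tt)))
  compR-sound x ([ φ ] var p)      _ prems = ⇒-firstʳ (R1R (⇒-lastʳ (prems tt)))
  compR-sound x ([ φ ] (¬' ψ))     _ prems = ⇒-firstʳ (R2R (⇒-lastʳ (prems tt)))
  compR-sound x ([ φ ] (ψ₁ ∧' ψ₂)) _ prems = ⇒-firstʳ (R3R (⇒-lastʳ (prems true)) (⇒-lastʳ (prems false)))
  compR-sound x ([ φ ] (ψ₁ →' ψ₂)) _ prems = ⇒-firstʳ (R4R (⇒-lastʳ (prems tt)))
  compR-sound x ([ φ ] K a ψ)      _ prems = ⇒-firstʳ (R5R (⇒-lastʳ (prems tt)))
  compR-sound x ([ φ ] ([ ψ ] χ))  _ prems = ⇒-firstʳ (R6R (⇒-lastʳ (prems tt)))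

  ⇒-axiom : (∀ {Γ Δ} → it ∷ Γ ⇒ Δ ++ it ∷ []) → it ∈ Γ → it ∈ Δ → Γ ⇒ Δ
  ⇒-axiom axiom it∈Γ it∈Δ with Γ' , Γ↭ ← ∈⇒↭∷ it∈Γ | Δ' , Δ↭ ← ∈⇒↭∷ it∈Δ =
    exch (↭-sym Γ↭) (↭-sym (↭-trans Δ↭ (++-comm (_ ∷ []) Δ'))) axiom

  ∈-∈⇒≡⊎↭ : ∀ {it'} → it ∈ Γ → it' ∈ Γ → it ≡ it' ⊎ ∃ λ Γ' → Γ ↭ it ∷ it' ∷ Γ'
  ∈-∈⇒≡⊎↭ (here refl) (here refl) = inj₁ refl
  ∈-∈⇒≡⊎↭ (here refl) (there m) with Γ' , Γ↭ ← ∈⇒↭∷ m = inj₂ (Γ' , prep _ Γ↭)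
  ∈-∈⇒≡⊎↭ (there m) (here refl) with Γ' , Γ↭ ← ∈⇒↭∷ m = inj₂ (Γ' , ↭-trans (prep _ Γ↭) (swap _ _ ↭-refl))
  ∈-∈⇒≡⊎↭ {Γ = it₀ ∷ _} (there m) (there m') with ∈-∈⇒≡⊎↭ m m'
  ... | inj₁ eq        = inj₁ eq
  ... | inj₂ (Γ' , Γ↭) = inj₂ (it₀ ∷ Γ' , ↭-trans (prep it₀ Γ↭) (shifts (it₀ ∷ []) (_ ∷ _ ∷ [])))

  ⊢-sound : Γ ⊢ Δ → Γ ⇒ Δ
  ⊢-sound (node (axP x p) Γ₀ Δ₀ Γ↭ Δ↭ (p∈Γ₀ ∷ []) (p∈Δ₀ ∷ []) _) =
    ⇒-axiom initP (∈-resp-↭ (↭-sym Γ↭) p∈Γ₀) (∈-resp-↭ (↭-sym Δ↭) p∈Δ₀)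
  ⊢-sound (node (axR x a y) Γ₀ Δ₀ Γ↭ Δ↭ (r∈Γ₀ ∷ []) (r∈Δ₀ ∷ []) _) =
    ⇒-axiom initR (∈-resp-↭ (↭-sym Γ↭) r∈Γ₀) (∈-resp-↭ (↭-sym Δ↭) r∈Δ₀)
  ⊢-sound (node (compL x F p) Γ₀ Δ₀ Γ↭ Δ↭ _ _ prems) =
    exch (↭-sym Γ↭) (↭-sym Δ↭) (compL-sound x F p λ i → ⊢-sound (prems i))
  ⊢-sound (node (compR x F p) Γ₀ Δ₀ Γ↭ Δ↭ _ _ prems) =
    exch (↭-sym Γ↭) (↭-sym Δ↭) (compR-sound x F p λ i → ⊢-sound (prems i))
  ⊢-sound (node (boxL x a φ y) Γ₀ Δ₀ Γ↭ Δ↭ (K∈Γ₀ ∷ xy∈Γ₀ ∷ []) _ prems) with ∈-∈⇒≡⊎↭ K∈Γ₀ xy∈Γ₀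
  ... | inj₁ ()
  ... | inj₂ (Γ₁ , Γ₀↭) =
    exch (↭-sym (↭-trans Γ↭ Γ₀↭)) (↭-sym Δ↭) (KL (exch (prep _ Γ₀↭) ↭-refl (⊢-sound (prems tt))))
  ⊢-sound (node (boxR x a φ used) Γ₀ Δ₀ Γ↭ Δ↭ _ _ prems)
    with y , y∉ ← fresh (used ++ x ∷ labels (Γ₀ ++ Δ₀)) =
    exch (↭-sym Γ↭) (↭-sym Δ↭)
      (⇒-firstʳ (KR (y∉ ∘ ∈-++⁺ʳ used ∘ there) (y∉ ∘ ∈-++⁺ʳ used ∘ here)
        (⇒-lastʳ (⊢-sound (prems (y , y∉ ∘ ∈-++⁺ˡ))))))
  ⊢-sound (node (reflexivity x a) Γ₀ Δ₀ Γ↭ Δ↭ _ _ prems) =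
    exch (↭-sym Γ↭) (↭-sym Δ↭) (Ref (⊢-sound (prems tt)))
  ⊢-sound (node (transitivity x y z a) Γ₀ Δ₀ Γ↭ Δ↭ (xy∈Γ₀ ∷ yz∈Γ₀ ∷ []) _ prems) with ∈-∈⇒≡⊎↭ xy∈Γ₀ yz∈Γ₀
  -- Both side atoms are one occurrence exactly when x = y = z, and then the premise is an instance of Ref.
  ... | inj₁ refl       = exch (↭-sym Γ↭) (↭-sym Δ↭) (Ref (⊢-sound (prems tt)))
  ... | inj₂ (Γ₁ , Γ₀↭) =
    exch (↭-sym (↭-trans Γ↭ Γ₀↭)) (↭-sym Δ↭) (Trans (exch (prep _ Γ₀↭) ↭-refl (⊢-sound (prems tt))))
  ⊢-sound (node (symmetry x y a) Γ₀ Δ₀ Γ↭ Δ↭ (xy∈Γ₀ ∷ []) _ prems) with Γ₁ , Γ₀↭ ← ∈⇒↭∷ xy∈Γ₀ =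
    exch (↭-sym (↭-trans Γ↭ Γ₀↭)) (↭-sym Δ↭) (Sym (exch (prep _ Γ₀↭) ↭-refl (⊢-sound (prems tt))))

  ⇒-weakenˡ : ∀ it → Γ ⇒ Δ → it ∷ Γ ⇒ Δ
  ⇒-weakenˡ it = ⊢-sound ∘ ⊢-weaken (it ∷ []) [] ∘ ⊢-complete

  ⇒-weakenʳ : ∀ it → Γ ⇒ Δ → Γ ⇒ Δ ++ it ∷ []
  ⇒-weakenʳ it = ⇒-lastʳ ∘ ⊢-sound ∘ ⊢-weaken [] (it ∷ []) ∘ ⊢-complete

  ⇒-contractˡ : ∀ it → it ∷ it ∷ Γ ⇒ Δ → it ∷ Γ ⇒ Δ
  ⇒-contractˡ it = ⊢-sound ∘ contractˡ it ∘ ⊢-complete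

  ⇒-contractʳ : ∀ it → Γ ⇒ Δ ++ it ∷ it ∷ [] → Γ ⇒ Δ ++ it ∷ []
  ⇒-contractʳ {Δ = Δ} it =
    ⇒-lastʳ ∘ ⊢-sound ∘ contractʳ it ∘ ⊢-exchʳ (++-comm Δ (it ∷ it ∷ [])) ∘ ⊢-complete

  ⇒-cut : Γ ⇒ Δ ++ lab x φ ∷ [] → lab x φ ∷ Γ' ⇒ Δ' → Γ ++ Γ' ⇒ Δ ++ Δ'
  ⇒-cut d₁ d₂ = ⊢-sound (cut (⊢-lastʳ (⊢-complete d₁)) (⊢-complete d₂))

mainTheorem4 : (n : ℕ) → let open PAL n in
    (∀ {x φ Γ Δ} → Γ ⇒ Δ → lab x φ ∷ Γ ⇒ Δ)
    × (∀ {x φ Γ Δ} → Γ ⇒ Δ → Γ ⇒ Δ ++ lab x φ ∷ [])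
    × (∀ {x φ Γ Δ} → lab x φ ∷ lab x φ ∷ Γ ⇒ Δ → lab x φ ∷ Γ ⇒ Δ)
    × (∀ {x φ Γ Δ} → Γ ⇒ Δ ++ lab x φ ∷ lab x φ ∷ [] → Γ ⇒ Δ ++ lab x φ ∷ [])
    × (∀ {x a y Γ Δ} → rel x a y ∷ rel x a y ∷ Γ ⇒ Δ → rel x a y ∷ Γ ⇒ Δ)
    × (∀ {x a y Γ Δ} → Γ ⇒ Δ ++ rel x a y ∷ rel x a y ∷ []
         → Γ ⇒ Δ ++ rel x a y ∷ [])
    × (∀ {x φ Γ Δ Γ' Δ'} → Γ ⇒ Δ ++ lab x φ ∷ [] → lab x φ ∷ Γ' ⇒ Δ'
         → Γ ++ Γ' ⇒ Δ ++ Δ')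
mainTheorem4 n =
    (λ {x} {φ} → ⇒-weakenˡ (lab x φ))
  , (λ {x} {φ} → ⇒-weakenʳ (lab x φ))
  , (λ {x} {φ} → ⇒-contractˡ (lab x φ))
  , (λ {x} {φ} → ⇒-contractʳ (lab x φ))
  , (λ {x} {a} {y} → ⇒-contractˡ (rel x a y))
  , (λ {x} {a} {y} → ⇒-contractʳ (rel x a y))
  , ⇒-cut
  where open PAL n
        open Admissibility n
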